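{- Assume the setting below and that the two conditions (1) and (2) below hold. Let $\mathcal{V}\subseteq\prod_{i\in N}\mathrm{Obj}(\mathbb{E}_{X_i})$. (i) $\mathcal{V}$ is an invariant for the Duplicator in the composite codensity game $\mathcal{G}$ if $\bigsqcup_{(P_i)_i\in\mathcal{V}}T^{\Omega}_{\sigma}(P_1,\dots,P_N)$ is an $F^{\Omega}_{\tau}$-bisimulation on the composite coalgebra $\lambda\circ T(c_1,\dots,c_N)$. (ii) $\overline{\mathcal{V}}$ is an invariant for the Duplicator in $\mathcal{G}$ if and only if $\bigsqcup_{(P_i)_i\in\overline{\mathcal{V}}}T^{\Omega}_{\sigma}(P_1,\dots,P_N)$ is an $F^{\Omega}_{\tau}$-bisimulation on $\lambda\circ T(c_1,\dots,c_N)$.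
   Context: Setting: $(p\colon\mathbb{E}\to\mathbb{B},O,\Omega)$ is a $\mathbf{CLat}_\sqcap$-fibration with truth values indexed by discrete $A$ (fibers are complete lattices with order $\sqsubseteq$, meet $\bigwedge$, join $\bigsqcup$, meet-preserving reindexing; $O=p\circ\Omega$); $F\colon\mathbb{B}\to\mathbb{B}$, $\tau\colon F\circ O\Rightarrow O$; $(T\colon\mathbb{B}^N\to\mathbb{B},\lambda\colon T\circ F^N\Rightarrow F\circ T)$ an $N$-ary one-step composition; $\sigma\colon T\circ\langle O,\dots,O\rangle\Rightarrow O$; $c_i\colon X_i\to FX_i$ ($i\in N$) are $F$-coalgebras. $F^{\Omega}_{\tau}(P)=\bigwedge_{a,\,k\in\mathbb{E}(P,\Omega(a))}(\tau_a\circ F(pk))^*\Omega(a)$ and $T^{\Omega}_{\sigma}(P_1,\dots,P_N)=\bigwedge_{a,\,k_i\in\mathbb{E}(P_i,\Omega(a))}(\sigma_a\circ T(pk_1,\dots,pk_N))^*\Omega(a)$. An $F^{\Omega}_{\tau}$-bisimulation on $c\colon X\to FX$ is $P\in\mathbb{E}_X$ with $P\sqsubseteq c^*F^{\Omega}_{\tau}(P)$. Conditions: (1) $\sigma_a\circ T(\tau_a,\dots,\tau_a)=\tau_a\circ F\sigma_a\circ\lambda$ for each $a\in A$; (2) for all $P_i\in\mathbb{E}$, $\bigwedge_{a,\,k_i\in\mathbb{E}(P_i,\Omega(a))}(\tau_a\circ F(\sigma_a\circ T(pk_1,\dots,pk_N)))^*\Omega(a)=F^{\Omega}_{\tau}(T^{\Omega}_{\sigma}(P_1,\dots,P_N))$.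 The composite codensity game $\mathcal{G}$ is the safety game with Duplicator positions $(a,(k_i)_i)$, $a\in A$, $k_i\in\mathbb{B}(X_i,O(a))$, Spoiler positions $(P_i)_i\in\prod_i\mathrm{Obj}(\mathbb{E}_{X_i})$, and moves $(P_i)_i\to(a,(k_i)_i)$ if $T^{\Omega}_{\sigma}(P_1,\dots,P_N)\not\sqsubseteq(\sigma_a\circ T(\tau_a\circ Fk_1\circ c_1,\dots,\tau_a\circ Fk_N\circ c_N))^*\Omega(a)$, and $(a,(k_i)_i)\to(P'_i)_i$ if there is $i$ with $P'_i\not\sqsubseteq k_i^*\Omega(a)$; Spoiler wins finite plays ending at a Duplicator position. A set $\mathcal{V}$ of Spoiler positions is an invariant for Duplicator if whenever $q\in\mathcal{V}$ and $q\to q'$ there is $q''\in\mathcal{V}$ with $q'\to q''$. The join-closure is $\overline{\mathcal{V}}=\mathcal{V}\cup\{(\bigsqcup_{(P_j)_j\in\mathcal{V}}P_i)_{i\in N}\}$. -}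

module Defs where

open import Level using (Level; suc)
open import Data.Product using (Σ; _×_; _,_; proj₁; proj₂; ∃)
open import Data.Sum using (_⊎_)
open import Relation.Nullary using (¬_)
open import Relation.Binary.PropositionalEquality using (_≡_)

record Category (ℓ : Level) : Set (suc ℓ) where
  infixr 9 _∘_
  field
    Ob    : Set ℓ
    Hom   : Ob → Ob → Set ℓ
    id    : ∀ {X} → Hom X X
    _∘_   : ∀ {X Y Z} → Hom Y Z → Hom X Y → Hom X Z
    assoc : ∀ {W X Y Z} (h : Hom Y Z) (g : Hom X Y) (f : Hom W X) →
            (h ∘ g) ∘ f ≡ h ∘ (g ∘ f)
    idˡ   : ∀ {X Y} (f : Hom X Y) → id ∘ f ≡ f
    idʳ   : ∀ {X Y} (f : Hom X Y) → f ∘ id ≡ f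

record Endofunctor {ℓ} (𝔹 : Category ℓ) : Set ℓ where
  open Category 𝔹
  field
    F₀   : Ob → Ob
    F₁   : ∀ {X Y} → Hom X Y → Hom (F₀ X) (F₀ Y)
    F-id : ∀ {X} → F₁ (id {X}) ≡ id
    F-∘  : ∀ {X Y Z} (g : Hom Y Z) (f : Hom X Y) → F₁ (g ∘ f) ≡ F₁ g ∘ F₁ f

record NaryFunctor {ℓ} (𝔹 : Category ℓ) (N : Set ℓ) : Set ℓ where
  open Category 𝔹
  field
    T₀   : (N → Ob) → Ob
    T₁   : ∀ {X Y : N → Ob} → ((i : N) → Hom (X i) (Y i)) → Hom (T₀ X) (T₀ Y)
    T-id : ∀ {X : N → Ob} → T₁ (λ i → id {X i}) ≡ id
    T-∘  : ∀ {X Y Z : N → Ob} (g : (i : N) → Hom (Y i) (Z i))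
           (f : (i : N) → Hom (X i) (Y i)) →
           T₁ (λ i → g i ∘ f i) ≡ T₁ g ∘ T₁ f

record CompleteLattice (ℓ : Level) : Set (suc ℓ) where
  infix 4 _⊑_
  field
    Carrier    : Set ℓ
    _⊑_        : Carrier → Carrier → Set ℓ
    ⊑-refl     : ∀ {x} → x ⊑ x
    ⊑-trans    : ∀ {x y z} → x ⊑ y → y ⊑ z → x ⊑ z
    ⊑-antisym  : ∀ {x y} → x ⊑ y → y ⊑ x → x ≡ y
    ⋀          : {I : Set ℓ} → (I → Carrier) → Carrier
    ⋀-lower    : ∀ {I} (f : I → Carrier) (i : I) → ⋀ f ⊑ f i
    ⋀-greatest : ∀ {I} (f : I → Carrier) x → (∀ i → x ⊑ f i) → x ⊑ ⋀ f
    ⋁          : {I : Set ℓ} → (I → Carrier) → Carrier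
    ⋁-upper    : ∀ {I} (f : I → Carrier) (i : I) → f i ⊑ ⋁ f
    ⋁-least    : ∀ {I} (f : I → Carrier) x → (∀ i → f i ⊑ x) → ⋁ f ⊑ x

-- CLat_⊓-fibrations over 𝔹, in their (equivalent) indexed-poset form:
-- the fibre 𝔼_X over each X is a complete lattice, reindexing f^* is
-- monotone, (strictly) functorial and meet-preserving.  A morphism
-- P → Q of the total category 𝔼 over f : X → Y is unique if it exists,
-- and exists iff P ⊑ f^* Q.

record CLatFibration {ℓ} (𝔹 : Category ℓ) : Set (suc ℓ) where
  open Category 𝔹
  field
    Fib : Ob → CompleteLattice ℓ
  Car : Ob → Set ℓ
  Car X = CompleteLattice.Carrier (Fib X)
  _⊑⟨_⟩_ : ∀ {X'} → Car X' → (X : Ob) → Car X' → Set ℓ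
  _⊑⟨_⟩_ {X'} P X Q = CompleteLattice._⊑_ (Fib X') P Q
  field
    _^* : ∀ {X Y} → Hom X Y → Car Y → Car X
    ^*-mono : ∀ {X Y} (f : Hom X Y) {P Q : Car Y} →
              CompleteLattice._⊑_ (Fib Y) P Q →
              CompleteLattice._⊑_ (Fib X) ((f ^*) P) ((f ^*) Q)
    ^*-id   : ∀ {X} (P : Car X) → (id ^*) P ≡ P
    ^*-∘    : ∀ {X Y Z} (g : Hom Y Z) (f : Hom X Y) (P : Car Z) →
              ((g ∘ f) ^*) P ≡ (f ^*) ((g ^*) P)
    ^*-⋀    : ∀ {X Y} (f : Hom X Y) {I : Set ℓ} (P : I → Car Y) →
              (f ^*) (CompleteLattice.⋀ (Fib Y) P)
                ≡ CompleteLattice.⋀ (Fib X) (λ i → (f ^*) (P i))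

record Setting (ℓ : Level) : Set (suc ℓ) where
  field
    𝔹   : Category ℓ
    fib : CLatFibration 𝔹
  open Category 𝔹 public
  open CLatFibration fib public
  field
    -- truth values indexed by a discrete category A
    A   : Set ℓ
    O   : A → Ob
    Ω   : (a : A) → Car (O a)          -- so that p ∘ Ω = O
    -- behaviour functor and modality τ : F ∘ O ⇒ O (A discrete)
    Fun : Endofunctor 𝔹
  open Endofunctor Fun public
  field
    τ   : (a : A) → Hom (F₀ (O a)) (O a)
    N   : Set ℓ
    Tf  : NaryFunctor 𝔹 N
  open NaryFunctor Tf public
  field
    lam     : (X : N → Ob) → Hom (T₀ (λ i → F₀ (X i))) (F₀ (T₀ X))
    lam-nat : ∀ {X Y : N → Ob} (f : (i : N) → Hom (X i) (Y i)) →
              lam Y ∘ T₁ (λ i → F₁ (f i)) ≡ F₁ (T₁ f) ∘ lam X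
    σ   : (a : A) → Hom (T₀ (λ _ → O a)) (O a)
    Xs  : N → Ob
    c   : (i : N) → Hom (Xs i) (F₀ (Xs i))

module _ {ℓ : Level} (S : Setting ℓ) where
  open Setting S
  private
    module L (X : Ob) = CompleteLattice (Fib X)

  -- morphisms P → Ω(a) in 𝔼 (identified with their image under p)
  EHom : (X : Ob) → Car X → A → Set ℓ
  EHom X P a = Σ (Hom X (O a)) λ f → P ⊑⟨ X ⟩ (f ^*) (Ω a)

  FΩτ : (X : Ob) → Car X → Car (F₀ X)
  FΩτ X P = L.⋀ (F₀ X) {I = Σ A (EHom X P)}
              (λ { (a , k , _) → ((τ a ∘ F₁ k) ^*) (Ω a) })

  TΩσ : (X : N → Ob) → ((i : N) → Car (X i)) → Car (T₀ X)
  TΩσ X P = L.⋀ (T₀ X) {I = Σ A (λ a → (i : N) → EHom (X i) (P i) a)}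
              (λ { (a , ks) → ((σ a ∘ T₁ (λ i → proj₁ (ks i))) ^*) (Ω a) })

  IsBisim : (Y : Ob) → Hom Y (F₀ Y) → Car Y → Set ℓ
  IsBisim Y d P = P ⊑⟨ Y ⟩ (d ^*) (FΩτ Y P)

  Cond1 : Set ℓ
  Cond1 = (a : A) → σ a ∘ T₁ (λ _ → τ a)
                      ≡ τ a ∘ (F₁ (σ a) ∘ lam (λ _ → O a))

  Cond2 : Set ℓ
  Cond2 = (X : N → Ob) (P : (i : N) → Car (X i)) →
          L.⋀ (F₀ (T₀ X)) {I = Σ A (λ a → (i : N) → EHom (X i) (P i) a)}
            (λ { (a , ks) →
                   ((τ a ∘ F₁ (σ a ∘ T₁ (λ i → proj₁ (ks i)))) ^*) (Ω a) })
          ≡ FΩτ (T₀ X) (TΩσ X P)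

  compCoalg : Hom (T₀ Xs) (F₀ (T₀ Xs))
  compCoalg = lam Xs ∘ T₁ c

  SpoilerPos : Set ℓ
  SpoilerPos = (i : N) → Car (Xs i)

  DuplicatorPos : Set ℓ
  DuplicatorPos = Σ A (λ a → (i : N) → Hom (Xs i) (O a))

  SpoilerMove : SpoilerPos → DuplicatorPos → Set ℓ
  SpoilerMove P (a , k) =
    ¬ (TΩσ Xs P ⊑⟨ T₀ Xs ⟩
         ((σ a ∘ T₁ (λ i → τ a ∘ (F₁ (k i) ∘ c i))) ^*) (Ω a))

  DuplicatorMove : DuplicatorPos → SpoilerPos → Set ℓ
  DuplicatorMove (a , k) P′ = Σ N (λ i → ¬ (P′ i ⊑⟨ Xs i ⟩ (k i ^*) (Ω a)))

  IsInvariant : (SpoilerPos → Set ℓ) → Set ℓ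
  IsInvariant V = ∀ q → V q → ∀ q′ → SpoilerMove q q′ →
                  Σ SpoilerPos (λ q″ → V q″ × DuplicatorMove q′ q″)

  joinClosure : (SpoilerPos → Set ℓ) → SpoilerPos → Set ℓ
  joinClosure V q =
    V q ⊎ (q ≡ (λ i → L.⋁ (Xs i) {I = Σ SpoilerPos V} (λ { (P , _) → P i })))

  joinT : (SpoilerPos → Set ℓ) → Car (T₀ Xs)
  joinT V = L.⋁ (T₀ Xs) {I = Σ SpoilerPos V} (λ { (P , _) → TΩσ Xs P })

-- Condition (1) and naturality of λ factor every Spoiler test σ_a ∘ T(τ_a ∘ Fk_i ∘ c_i) through
-- the composite coalgebra as (τ_a ∘ F(σ_a ∘ Tk)) ∘ λ ∘ Tc. Hence a Spoiler move (a, k) from below a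
-- bisimulation R is legal only if R ⋢ (σ_a ∘ Tk)^*Ω(a), which, for R the join of T^Ω_σ over V, means
-- some position of V is not below k^*Ω(a): that position is Duplicator's answer. Conversely, the
-- join-closure has a greatest position ⋁V whose T^Ω_σ is the whole join; by condition (2), being a
-- bisimulation amounts to T^Ω_σ(⋁V) lying below every Spoiler test, and a test it failed would be a
-- Spoiler move from ⋁V that no position of the closure, all below ⋁V, could answer.
module Submission where

open import Defs
open import Level using (Level)
open import Data.Product using (_×_; Σ; _,_; proj₁; proj₂)
open import Data.Sum using (inj₁; inj₂)
open import Relation.Binary.PropositionalEquality using (_≡_; refl; sym; trans; cong; subst)
open import Function.Bundles using (_⇔_; mk⇔)
open import Axiom.ExcludedMiddle using (ExcludedMiddle)
open import Axiom.DoubleNegationElimination using (em⇒dne)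

module _ {ℓ : Level} (S : Setting ℓ) where
  open Setting S
  open Relation.Binary.PropositionalEquality.≡-Reasoning
  private
    module L (X : Ob) = CompleteLattice (Fib X)

  spoilerTest : (a : A) → ((i : N) → Hom (Xs i) (O a)) → Hom (T₀ Xs) (O a)
  spoilerTest a k = σ a ∘ T₁ (λ i → τ a ∘ (F₁ (k i) ∘ c i))

  spoilerTest-factors : Cond1 S → (a : A) (k : (i : N) → Hom (Xs i) (O a)) →
                        spoilerTest a k ≡ (τ a ∘ F₁ (σ a ∘ T₁ k)) ∘ compCoalg S
  spoilerTest-factors cond1 a k = begin
    σ a ∘ T₁ (λ i → τ a ∘ (F₁ (k i) ∘ c i))
      ≡⟨ cong (σ a ∘_) (T-∘ (λ _ → τ a) (λ i → F₁ (k i) ∘ c i)) ⟩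
    σ a ∘ (T₁ (λ _ → τ a) ∘ T₁ (λ i → F₁ (k i) ∘ c i))
      ≡⟨ cong (λ z → σ a ∘ (T₁ (λ _ → τ a) ∘ z)) (T-∘ (λ i → F₁ (k i)) c) ⟩
    σ a ∘ (T₁ (λ _ → τ a) ∘ (T₁ (λ i → F₁ (k i)) ∘ T₁ c))
      ≡⟨ sym (assoc _ _ _) ⟩
    (σ a ∘ T₁ (λ _ → τ a)) ∘ (T₁ (λ i → F₁ (k i)) ∘ T₁ c)
      ≡⟨ cong (_∘ (T₁ (λ i → F₁ (k i)) ∘ T₁ c)) (cond1 a) ⟩
    (τ a ∘ (F₁ (σ a) ∘ lam (λ _ → O a))) ∘ (T₁ (λ i → F₁ (k i)) ∘ T₁ c)
      ≡⟨ trans (assoc _ _ _) (cong (τ a ∘_) (assoc _ _ _)) ⟩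
    τ a ∘ (F₁ (σ a) ∘ (lam (λ _ → O a) ∘ (T₁ (λ i → F₁ (k i)) ∘ T₁ c)))
      ≡⟨ cong (λ z → τ a ∘ (F₁ (σ a) ∘ z)) (sym (assoc _ _ _)) ⟩
    τ a ∘ (F₁ (σ a) ∘ ((lam (λ _ → O a) ∘ T₁ (λ i → F₁ (k i))) ∘ T₁ c))
      ≡⟨ cong (λ z → τ a ∘ (F₁ (σ a) ∘ (z ∘ T₁ c))) (lam-nat k) ⟩
    τ a ∘ (F₁ (σ a) ∘ ((F₁ (T₁ k) ∘ lam Xs) ∘ T₁ c))
      ≡⟨ cong (λ z → τ a ∘ (F₁ (σ a) ∘ z)) (assoc _ _ _) ⟩
    τ a ∘ (F₁ (σ a) ∘ (F₁ (T₁ k) ∘ compCoalg S))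
      ≡⟨ cong (τ a ∘_) (sym (assoc _ _ _)) ⟩
    τ a ∘ ((F₁ (σ a) ∘ F₁ (T₁ k)) ∘ compCoalg S)
      ≡⟨ cong (λ z → τ a ∘ (z ∘ compCoalg S)) (sym (F-∘ _ _)) ⟩
    τ a ∘ (F₁ (σ a ∘ T₁ k) ∘ compCoalg S)
      ≡⟨ sym (assoc _ _ _) ⟩
    (τ a ∘ F₁ (σ a ∘ T₁ k)) ∘ compCoalg S ∎

  spoilerTest-reindex : Cond1 S → (a : A) (k : (i : N) → Hom (Xs i) (O a)) →
                        (spoilerTest a k ^*) (Ω a)
                          ≡ (compCoalg S ^*) (((τ a ∘ F₁ (σ a ∘ T₁ k)) ^*) (Ω a))
  spoilerTest-reindex cond1 a k =
    trans (cong (λ f → (f ^*) (Ω a)) (spoilerTest-factors cond1 a k))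
          (^*-∘ _ (compCoalg S) (Ω a))

  TΩσ-mono : (P Q : SpoilerPos S) → (∀ i → P i ⊑⟨ Xs i ⟩ Q i) →
             TΩσ S Xs P ⊑⟨ T₀ Xs ⟩ TΩσ S Xs Q
  TΩσ-mono P Q P⊑Q = L.⋀-greatest (T₀ Xs) _ _ λ { (a , ks) →
    L.⋀-lower (T₀ Xs) _
      (a , λ i → proj₁ (ks i) , L.⊑-trans (Xs i) (P⊑Q i) (proj₂ (ks i))) }

  joinT-below-test : (W : SpoilerPos S → Set ℓ) (a : A) (k : (i : N) → Hom (Xs i) (O a)) →
                     (∀ P → W P → ∀ i → P i ⊑⟨ Xs i ⟩ (k i ^*) (Ω a)) →
                     joinT S W ⊑⟨ T₀ Xs ⟩ ((σ a ∘ T₁ k) ^*) (Ω a)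
  joinT-below-test W a k W⊑k = L.⋁-least (T₀ Xs) _ _ λ { (P , w) →
    L.⋀-lower (T₀ Xs) _ (a , λ i → k i , W⊑k P w i) }

  bisim-below-spoilerTest : Cond1 S → (R : Car (T₀ Xs)) → IsBisim S _ (compCoalg S) R →
                            (a : A) (k : (i : N) → Hom (Xs i) (O a)) →
                            R ⊑⟨ T₀ Xs ⟩ ((σ a ∘ T₁ k) ^*) (Ω a) →
                            R ⊑⟨ T₀ Xs ⟩ (spoilerTest a k ^*) (Ω a)
  bisim-below-spoilerTest cond1 R bisim a k R⊑σTk =
    subst (R ⊑⟨ T₀ Xs ⟩_) (sym (spoilerTest-reindex cond1 a k))
      (L.⊑-trans (T₀ Xs) bisim
        (^*-mono (compCoalg S) (L.⋀-lower (F₀ (T₀ Xs)) _ (a , σ a ∘ T₁ k , R⊑σTk))))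

  duplicator-answers : ExcludedMiddle ℓ → Cond1 S → (W : SpoilerPos S → Set ℓ) →
                       IsBisim S _ (compCoalg S) (joinT S W) →
                       ∀ q → TΩσ S Xs q ⊑⟨ T₀ Xs ⟩ joinT S W →
                       ∀ q′ → SpoilerMove S q q′ →
                       Σ (SpoilerPos S) (λ q″ → W q″ × DuplicatorMove S q′ q″)
  duplicator-answers em cond1 W bisim q q⊑W (a , k) move = em⇒dne em λ noAnswer →
    let W⊑k : ∀ P → W P → ∀ i → P i ⊑⟨ Xs i ⟩ (k i ^*) (Ω a)
        W⊑k P w i = em⇒dne em λ P⋢k → noAnswer (P , w , i , P⋢k)
    in move (L.⊑-trans (T₀ Xs) q⊑W
              (bisim-below-spoilerTest cond1 _ bisim a k (joinT-below-test W a k W⊑k)))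

  bisim⇒invariant : ExcludedMiddle ℓ → Cond1 S → (V : SpoilerPos S → Set ℓ) →
                    IsBisim S _ (compCoalg S) (joinT S V) → IsInvariant S V
  bisim⇒invariant em cond1 V bisim q v =
    duplicator-answers em cond1 V bisim q (L.⋁-upper (T₀ Xs) _ (q , v))

  module _ (V : SpoilerPos S → Set ℓ) where

    ⋁V : SpoilerPos S
    ⋁V i = L.⋁ (Xs i) {I = Σ (SpoilerPos S) V} (λ { (P , _) → P i })

    ⋁V-greatest : ∀ q → joinClosure S V q → ∀ i → q i ⊑⟨ Xs i ⟩ ⋁V i
    ⋁V-greatest q (inj₁ v)    i = L.⋁-upper (Xs i) _ (q , v)
    ⋁V-greatest q (inj₂ q≡⋁V) i =
      subst (λ P → P i ⊑⟨ Xs i ⟩ ⋁V i) (sym q≡⋁V) (L.⊑-refl (Xs i))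

    joinT-joinClosure : joinT S (joinClosure S V) ≡ TΩσ S Xs ⋁V
    joinT-joinClosure = L.⊑-antisym (T₀ Xs)
      (L.⋁-least (T₀ Xs) _ _ λ { (q , w) → TΩσ-mono q ⋁V (⋁V-greatest q w) })
      (L.⋁-upper (T₀ Xs) _ (⋁V , inj₂ refl))

    FΩτ-TΩσ-reindex : Cond2 S →
      (compCoalg S ^*) (FΩτ S (T₀ Xs) (TΩσ S Xs ⋁V))
        ≡ L.⋀ (T₀ Xs) {I = Σ A (λ a → (i : N) → EHom S (Xs i) (⋁V i) a)}
            (λ { (a , ks) → (compCoalg S ^*)
                   (((τ a ∘ F₁ (σ a ∘ T₁ (λ i → proj₁ (ks i)))) ^*) (Ω a)) })
    FΩτ-TΩσ-reindex cond2 =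
      trans (cong (compCoalg S ^*) (sym (cond2 Xs ⋁V))) (^*-⋀ (compCoalg S) _)

    invariant⇒bisim : ExcludedMiddle ℓ → Cond1 S → Cond2 S →
                      IsInvariant S (joinClosure S V) →
                      IsBisim S _ (compCoalg S) (joinT S (joinClosure S V))
    invariant⇒bisim em cond1 cond2 inv =
      subst (λ R → IsBisim S _ (compCoalg S) R) (sym joinT-joinClosure)
        (subst (TΩσ S Xs ⋁V ⊑⟨ T₀ Xs ⟩_) (sym (FΩτ-TΩσ-reindex cond2))
          (L.⋀-greatest (T₀ Xs) _ _ λ { (a , ks) →
            passes a (λ i → proj₁ (ks i)) (λ i → proj₂ (ks i)) }))
      where
        passes : (a : A) (k : (i : N) → Hom (Xs i) (O a)) →
                 (∀ i → ⋁V i ⊑⟨ Xs i ⟩ (k i ^*) (Ω a)) →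
                 TΩσ S Xs ⋁V ⊑⟨ T₀ Xs ⟩
                   (compCoalg S ^*) (((τ a ∘ F₁ (σ a ∘ T₁ k)) ^*) (Ω a))
        passes a k ⋁V⊑k = em⇒dne em λ fails →
          let (q″ , w , i , q″⋢k) =
                inv ⋁V (inj₂ refl) (a , k)
                  (λ passes′ → fails (subst (TΩσ S Xs ⋁V ⊑⟨ T₀ Xs ⟩_)
                                        (spoilerTest-reindex cond1 a k) passes′))
          in q″⋢k (L.⊑-trans (Xs i) (⋁V-greatest q″ w i) (⋁V⊑k i))

theorem5 : {ℓ : Level} → ExcludedMiddle ℓ → (S : Setting ℓ) →
           Cond1 S → Cond2 S → (V : SpoilerPos S → Set ℓ) →
           (IsBisim S _ (compCoalg S) (joinT S V) → IsInvariant S V)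
           × (IsInvariant S (joinClosure S V)
               ⇔ IsBisim S _ (compCoalg S) (joinT S (joinClosure S V)))
theorem5 em S cond1 cond2 V =
  bisim⇒invariant S em cond1 V ,
  mk⇔ (invariant⇒bisim S V em cond1 cond2) (bisim⇒invariant S em cond1 (joinClosure S V))
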